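{- Let $1/n\ll\varepsilon\ll1$ and let $T$ be an $n$-vertex tree. Then there is a partition $V(T)=A\cup B$ with $|A|,|B|\le(2/3-\varepsilon)n$ such that $T[A]$ is a tree and $\{v\in A: d_T(v,B)>0\}$ is an independent set in $T$ of size at most $2$.
   Context: Hierarchy notation "$1/n\ll\varepsilon\ll1$": $\varepsilon$ is sufficiently small and $n$ sufficiently large in terms of $\varepsilon$. $d_T(v,B)$ is the number of neighbours of $v$ in $B$ in $T$, and $T[A]$ is the subgraph induced by $A$. -}

module Defs where

open import Data.Nat using (ℕ; _≤_)
open import Data.Bool using (Bool; true; false)
open import Data.Fin using (Fin)
open import Data.Fin.Subset using (Subset; _∈_; _∉_; ∣_∣; ∁; ⊤)
open import Data.List using (List; []; _∷_; _++_; length)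
open import Data.List.Relation.Unary.All using (All)
open import Data.List.Relation.Unary.Unique.Propositional using (Unique)
open import Data.Product using (Σ; ∃; ∃-syntax; _×_)
open import Data.Integer using (+_)
open import Data.Rational using (ℚ; _/_; _-_; _*_; _≤_)
open import Relation.Binary.PropositionalEquality using (_≡_)
open import Relation.Nullary using (¬_)
import Data.Unit as U

record Graph (n : ℕ) : Set where
  field
    adj    : Fin n → Fin n → Bool
    sym    : ∀ u v → adj u v ≡ adj v u
    irrefl : ∀ v → adj v v ≡ false
open Graph public

Adj : ∀ {n} → Graph n → Fin n → Fin n → Set
Adj G u v = adj G u v ≡ true

-- Walks from u to v all of whose vertices after u lie in S.
data Walk {n} (G : Graph n) (S : Subset n) : Fin n → Fin n → Set where
  here : ∀ {v} → Walk G S v v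
  step : ∀ {u w v} → Adj G u w → w ∈ S → Walk G S w v → Walk G S u v

Chain : ∀ {n} → Graph n → List (Fin n) → Set
Chain G [] = U.⊤
Chain G (x ∷ []) = U.⊤
Chain G (x ∷ y ∷ xs) = Adj G x y × Chain G (y ∷ xs)

HasCycleIn : ∀ {n} → Graph n → Subset n → Set
HasCycleIn G S = ∃[ x ] ∃[ xs ]
  (2 Data.Nat.≤ length xs × Unique (x ∷ xs) × All (_∈ S) (x ∷ xs) × Chain G (x ∷ xs ++ x ∷ []))

IsTreeOn : ∀ {n} → Graph n → Subset n → Set
IsTreeOn G S =
  (∃[ v ] v ∈ S) ×
  (∀ u v → u ∈ S → v ∈ S → Walk G S u v) ×
  ¬ HasCycleIn G S

IsTree : ∀ {n} → Graph n → Set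
IsTree G = IsTreeOn G ⊤

Independent : ∀ {n} → Graph n → Subset n → Set
Independent G I = ∀ u v → u ∈ I → v ∈ I → ¬ Adj G u v

ℕtoℚ : ℕ → ℚ
ℕtoℚ k = (+ k) / 1

module Submission where

-- Root T at a vertex r: breadth-first search gives depths and parents, and acyclicity
-- forces every edge to join a vertex to its parent. A set S ∋ r closed under ancestors is
-- a cut at y, z if every edge leaving S starts at y or z; it induces a subtree, and for
-- non-adjacent y, z its attachment set is independent of size at most 2. So it suffices to
-- find such a cut with 3n/8 ≤ |S| ≤ 5n/8: then both sides have at most 5n/8 = (2/3 − 1/24) n
-- vertices.
-- Take c deepest with size c > 5n/8, where size x counts the descendants of x. If some child
-- of c has size in [3n/8, 5n/8], cut off its subtree. Otherwise all children have size
-- < 3n/8. Starting from S = V, or from V minus the subtree of the unique child of size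
-- > n/4 if there is one, remove the subtrees of the other children one at a time: |S| starts
-- above 5n/8, drops by at most n/4 per step and ends at most n − size c + 1 ≤ 5n/8, so it
-- passes through the window. If c has two children of size > n/4, descend from each to a
-- vertex y resp. z of size > n/4 all of whose children have size ≤ n/4, and remove the
-- subtrees of all children of y and z instead; this ends with at most
-- n − size y − size z + 2 ≤ 5n/8 vertices once n ≥ 12.

module TreeSplitting where

  open import Defs using (Graph; Adj; Walk; here; step; Chain; HasCycleIn; IsTreeOn; IsTree; Independent)
  open import Data.Bool using (true)
  import Data.Bool as Bool
  open import Data.Fin using (Fin; _≟_)
  open import Data.Fin.Properties using (any?)
  open import Data.Fin.Subset
    using (Subset; _∈_; _∉_; _⊆_; ∣_∣; ∁; ⊤; ⊥; ⁅_⁆; _∪_; _∩_; _─_; ⋃; Empty; inside; outside)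
  open import Data.Fin.Subset.Properties
    using (∈⊤; _∈?_; ∣p∣≤n; ∣⊤∣≡n; ∣⊥∣≡0; ∣⁅x⁆∣≡1; Empty-unique; p⊆q⇒∣p∣≤∣q∣; p⊂q⇒∣p∣<∣q∣; p∪∁p≡⊤;
           x∈p∪q⁺; x∈p∪q⁻; x∈p∩q⁺; x∈p∩q⁻; x∈∁p⇒x∉p; x∈p∧x∉q⇒x∈p─q; x∈⁅x⁆; p─⊥≡p; p─q⊆p; p─q─r≡p─q∪r)
  open import Data.List
    using (List; []; _∷_; _++_; length; last; map; filter; allFin; applyUpTo; applyDownFrom)
  open import Data.List.Properties using (length-++-sucʳ)
  open import Data.List.Membership.Propositional using () renaming (_∈_ to _∈ₗ_)
  open import Data.List.Membership.Propositional.Properties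
    using (∈-applyUpTo⁻; ∈-applyDownFrom⁻; ∈-++⁻; ∈-map⁺; ∈-filter⁺; ∈-allFin)
  open import Data.List.Relation.Binary.Disjoint.Propositional using (Disjoint)
  open import Data.List.Relation.Unary.All as All using (All; []; _∷_)
  open import Data.List.Relation.Unary.All.Properties using (all-filter)
  open import Data.List.Relation.Unary.AllPairs using (_∷_)
  open import Data.List.Relation.Unary.Any using () renaming (here to hereₗ; there to thereₗ)
  open import Data.List.Relation.Unary.Linked using (Linked; []; [-]; _∷_)
  import Data.List.Relation.Unary.Linked.Properties as Linked
  open import Data.List.Relation.Unary.Unique.Propositional using (Unique)
  import Data.List.Relation.Unary.Unique.Propositional.Properties as Unique
  open import Data.Maybe using (just)
  open import Data.Maybe.Relation.Binary.Connected using (Connected; just)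
  open import Data.Nat
    using (ℕ; zero; suc; pred; _+_; _*_; _≤_; _<_; _≤?_; _<?_; z≤n; z<s; s≤s; s<s⁻¹; s≤s⁻¹;
           NonZero; >-nonZero; ≢-nonZero)
  open import Data.Nat.Induction using (<-wellFounded)
  open import Data.Nat.Properties hiding (_≟_)
  open import Data.Nat.Solver using (module +-*-Solver)
  open import Data.Product using (∃-syntax; _×_; _,_; proj₁; proj₂)
  open import Data.Sum using (_⊎_; inj₁; inj₂; [_,_]′)
  import Data.Sum as Sum
  open import Data.Unit using (tt)
  open import Data.Vec using ([]; _∷_; tabulate)
  import Data.Vec.Base as Vec
  open import Data.Vec.Properties using (lookup∘tabulate; []=⇒lookup; lookup⇒[]=)
  open import Function using (_∘_; flip)
  open import Function.Bundles using (_⇔_; mk⇔)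
  open import Induction.WellFounded using (Acc; acc)
  open import Relation.Binary using (tri<; tri≈; tri>)
  open import Relation.Binary.PropositionalEquality
    using (_≡_; _≢_; refl; sym; trans; cong; cong₂; subst; module ≡-Reasoning)
  open import Relation.Nullary using (Dec; yes; no; does; ¬_; contradiction)
  open import Relation.Nullary.Decidable using (dec-true; map′; ¬?; _×-dec_; _⊎-dec_)
  open import Relation.Unary using (Pred; Decidable)

  open +-*-Solver using (solve; _:=_; _:+_; _:*_; con)

  private variable
    A : Set
    n a b s t : ℕ

  module _ {ℓ} {P : Pred (Fin n) ℓ} (P? : Decidable P) where

    subset : Subset n
    subset = tabulate (does ∘ P?)

    ∈-subset⁺ : ∀ {x} → P x → x ∈ subset
    ∈-subset⁺ {x} px = lookup⇒[]= x subset (trans (lookup∘tabulate (does ∘ P?) x) (dec-true (P? x) px))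

    ∈-subset⁻ : ∀ {x} → x ∈ subset → P x
    ∈-subset⁻ {x} x∈ with P? x | trans (sym (lookup∘tabulate (does ∘ P?) x)) ([]=⇒lookup x∈)
    ... | yes px | _ = px

  x∈p─q⇒x∉q : ∀ {p q : Subset n} {x} → x ∈ p ─ q → x ∉ q
  x∈p─q⇒x∉q {p = _ ∷ _} {outside ∷ _} (Vec.there x∈) (Vec.there x∈q) = x∈p─q⇒x∉q x∈ x∈q
  x∈p─q⇒x∉q {p = _ ∷ _} {inside ∷ _}  (Vec.there x∈) (Vec.there x∈q) = x∈p─q⇒x∉q x∈ x∈q

  ∣p∪q∣+∣p∩q∣≡∣p∣+∣q∣ : ∀ (p q : Subset n) → ∣ p ∪ q ∣ + ∣ p ∩ q ∣ ≡ ∣ p ∣ + ∣ q ∣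
  ∣p∪q∣+∣p∩q∣≡∣p∣+∣q∣ [] [] = refl
  ∣p∪q∣+∣p∩q∣≡∣p∣+∣q∣ (inside ∷ p) (inside ∷ q) =
    cong suc (trans (+-suc _ _) (trans (cong suc (∣p∪q∣+∣p∩q∣≡∣p∣+∣q∣ p q)) (sym (+-suc _ _))))
  ∣p∪q∣+∣p∩q∣≡∣p∣+∣q∣ (inside ∷ p) (outside ∷ q) = cong suc (∣p∪q∣+∣p∩q∣≡∣p∣+∣q∣ p q)
  ∣p∪q∣+∣p∩q∣≡∣p∣+∣q∣ (outside ∷ p) (inside ∷ q) =
    trans (cong suc (∣p∪q∣+∣p∩q∣≡∣p∣+∣q∣ p q)) (sym (+-suc _ _))
  ∣p∪q∣+∣p∩q∣≡∣p∣+∣q∣ (outside ∷ p) (outside ∷ q) = ∣p∪q∣+∣p∩q∣≡∣p∣+∣q∣ p q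

  ∣p∪q∣≤∣p∣+∣q∣ : ∀ (p q : Subset n) → ∣ p ∪ q ∣ ≤ ∣ p ∣ + ∣ q ∣
  ∣p∪q∣≤∣p∣+∣q∣ p q = m+n≤o⇒m≤o ∣ p ∪ q ∣ (≤-reflexive (∣p∪q∣+∣p∩q∣≡∣p∣+∣q∣ p q))

  ∣p∣+∣q∣≤n+∣p∩q∣ : ∀ (p q : Subset n) → ∣ p ∣ + ∣ q ∣ ≤ n + ∣ p ∩ q ∣
  ∣p∣+∣q∣≤n+∣p∩q∣ {n} p q =
    subst (_≤ n + ∣ p ∩ q ∣) (∣p∪q∣+∣p∩q∣≡∣p∣+∣q∣ p q) (+-monoˡ-≤ ∣ p ∩ q ∣ (∣p∣≤n (p ∪ q)))

  Empty[p∩q]⇒∣p∪q∣≡∣p∣+∣q∣ : ∀ (p q : Subset n) → Empty (p ∩ q) → ∣ p ∪ q ∣ ≡ ∣ p ∣ + ∣ q ∣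
  Empty[p∩q]⇒∣p∪q∣≡∣p∣+∣q∣ {n} p q disjoint = begin
    ∣ p ∪ q ∣                ≡⟨ sym (+-identityʳ _) ⟩
    ∣ p ∪ q ∣ + 0            ≡⟨ cong (∣ p ∪ q ∣ +_) (sym (∣⊥∣≡0 n)) ⟩
    ∣ p ∪ q ∣ + ∣ ⊥ {n} ∣    ≡⟨ cong (λ s → ∣ p ∪ q ∣ + ∣ s ∣) (sym (Empty-unique disjoint)) ⟩
    ∣ p ∪ q ∣ + ∣ p ∩ q ∣    ≡⟨ ∣p∪q∣+∣p∩q∣≡∣p∣+∣q∣ p q ⟩
    ∣ p ∣ + ∣ q ∣            ∎
    where open ≡-Reasoning

  ∣p∣≤∣p─q∣+∣q∣ : ∀ (p q : Subset n) → ∣ p ∣ ≤ ∣ p ─ q ∣ + ∣ q ∣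
  ∣p∣≤∣p─q∣+∣q∣ p q = ≤-trans (p⊆q⇒∣p∣≤∣q∣ p⊆[p─q]∪q) (∣p∪q∣≤∣p∣+∣q∣ (p ─ q) q)
    where
    p⊆[p─q]∪q : p ⊆ (p ─ q) ∪ q
    p⊆[p─q]∪q {x} x∈p with x ∈? q
    ... | yes x∈q = x∈p∪q⁺ (inj₂ x∈q)
    ... | no x∉q  = x∈p∪q⁺ (inj₁ (x∈p∧x∉q⇒x∈p─q x∈p x∉q))

  ∣p─q∣+∣q∣≤n : ∀ (p q : Subset n) → ∣ p ─ q ∣ + ∣ q ∣ ≤ n
  ∣p─q∣+∣q∣≤n {n} p q = subst (_≤ n) (Empty[p∩q]⇒∣p∪q∣≡∣p∣+∣q∣ (p ─ q) q disjoint) (∣p∣≤n ((p ─ q) ∪ q))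
    where
    disjoint : Empty ((p ─ q) ∩ q)
    disjoint (x , x∈) = let (x∈p─q , x∈q) = x∈p∩q⁻ (p ─ q) q x∈ in x∈p─q⇒x∉q x∈p─q x∈q

  ∣p∣+∣∁p∣≡n : ∀ (p : Subset n) → ∣ p ∣ + ∣ ∁ p ∣ ≡ n
  ∣p∣+∣∁p∣≡n {n} p = begin
    ∣ p ∣ + ∣ ∁ p ∣  ≡⟨ sym (Empty[p∩q]⇒∣p∪q∣≡∣p∣+∣q∣ p (∁ p) disjoint) ⟩
    ∣ p ∪ ∁ p ∣      ≡⟨ cong ∣_∣ (p∪∁p≡⊤ p) ⟩
    ∣ ⊤ {n} ∣        ≡⟨ ∣⊤∣≡n n ⟩
    n                ∎
    where
    open ≡-Reasoning
    disjoint : Empty (p ∩ ∁ p)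
    disjoint (x , x∈) = let (x∈p , x∈∁p) = x∈p∩q⁻ p (∁ p) x∈ in x∈∁p⇒x∉p x∈∁p x∈p

  ∈-⁅x⁆∪⁅y⁆⁺ : ∀ {x y v : Fin n} → v ≡ x ⊎ v ≡ y → v ∈ ⁅ x ⁆ ∪ ⁅ y ⁆
  ∈-⁅x⁆∪⁅y⁆⁺ {x = x} (inj₁ refl) = x∈p∪q⁺ (inj₁ (x∈⁅x⁆ x))
  ∈-⁅x⁆∪⁅y⁆⁺ {y = y} (inj₂ refl) = x∈p∪q⁺ (inj₂ (x∈⁅x⁆ y))

  ∣⁅x⁆∪⁅y⁆∣≤2 : ∀ (x y : Fin n) → ∣ ⁅ x ⁆ ∪ ⁅ y ⁆ ∣ ≤ 2
  ∣⁅x⁆∪⁅y⁆∣≤2 x y = ≤-trans (∣p∪q∣≤∣p∣+∣q∣ ⁅ x ⁆ ⁅ y ⁆) (≤-reflexive (cong₂ _+_ (∣⁅x⁆∣≡1 x) (∣⁅x⁆∣≡1 y)))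

  ∈-⋃⁺ : ∀ {ps : List (Subset n)} {p x} → p ∈ₗ ps → x ∈ p → x ∈ ⋃ ps
  ∈-⋃⁺ (hereₗ refl) x∈p = x∈p∪q⁺ (inj₁ x∈p)
  ∈-⋃⁺ (thereₗ p∈ps) x∈p = x∈p∪q⁺ (inj₂ (∈-⋃⁺ p∈ps x∈p))

  minimal : ∀ {ℓ} {P : Pred ℕ ℓ} → Decidable P → ∀ {m} → P m → ∃[ k ] (P k × (∀ {j} → j < k → ¬ P j))
  minimal P? {zero} p0 = 0 , p0 , λ ()
  minimal P? {suc m} pm with P? 0
  ... | yes p0 = 0 , p0 , λ ()
  ... | no ¬p0 with minimal (P? ∘ suc) pm
  ... | k , pk , below = suc k , pk , λ { {zero} _ → ¬p0 ; {suc j} (s≤s j<k) → below j<k }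

  last-applyUpTo : ∀ (f : ℕ → A) m → last (applyUpTo f (suc m)) ≡ just (f m)
  last-applyUpTo f zero    = refl
  last-applyUpTo f (suc m) = last-applyUpTo (f ∘ suc) m

  last-applyDownFrom : ∀ (f : ℕ → A) m → last (applyDownFrom f (suc m)) ≡ just (f 0)
  last-applyDownFrom f zero    = refl
  last-applyDownFrom f (suc m) = last-applyDownFrom f m

  last-++ : ∀ (xs : List A) y ys → last (xs ++ y ∷ ys) ≡ last (y ∷ ys)
  last-++ []           y ys = refl
  last-++ (x ∷ [])     y ys = refl
  last-++ (x ∷ x′ ∷ xs) y ys = last-++ (x′ ∷ xs) y ys

  _◅◅_ : ∀ {G : Graph n} {S u v w} → Walk G S u v → Walk G S v w → Walk G S u w
  here         ◅◅ q = q
  step a w∈S p ◅◅ q = step a w∈S (p ◅◅ q)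

  module _ (G : Graph n) where

    adj? : ∀ u v → Dec (Adj G u v)
    adj? u v = Graph.adj G u v Bool.≟ true

    Adj-sym : ∀ {u v} → Adj G u v → Adj G v u
    Adj-sym {u} {v} a = trans (Graph.sym G v u) a

    Adj-irrefl : ∀ {v} → ¬ Adj G v v
    Adj-irrefl {v} a with () ← trans (sym a) (Graph.irrefl G v)

    Adj⇒≢ : ∀ {u v} → Adj G u v → u ≢ v
    Adj⇒≢ a refl = Adj-irrefl a

    Linked⇒Chain : ∀ {xs} → Linked (Adj G) xs → Chain G xs
    Linked⇒Chain []      = tt
    Linked⇒Chain [-]     = tt
    Linked⇒Chain (a ∷ l) = a , Linked⇒Chain l

    closed-path⇒cycle : ∀ {x y xs} → Linked (Adj G) (x ∷ xs) → last (x ∷ xs) ≡ just y → Adj G y x →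
                        Unique (x ∷ xs) → 2 ≤ length xs → HasCycleIn G ⊤
    closed-path⇒cycle {x} {y} {xs} linked ends closing unique long =
      x , xs , long , unique , All.universal (λ _ → ∈⊤) (x ∷ xs) ,
      Linked⇒Chain (Linked.++⁺ linked joint [-])
      where
      joint : Connected (Adj G) (last (x ∷ xs)) (just x)
      joint = subst (λ l → Connected (Adj G) l (just x)) (sym ends) (just closing)

  module BreadthFirst (G : Graph n) (r : Fin n) (connected : ∀ v → Walk G ⊤ r v) where

    Near : ℕ → Fin n → Set
    Near zero    v = v ≡ r
    Near (suc k) v = Near k v ⊎ ∃[ u ] (Near k u × Adj G u v)

    near? : ∀ k → Decidable (Near k)
    near? zero    v = v ≟ r
    near? (suc k) v = near? k v ⊎-dec any? (λ u → near? k u ×-dec adj? G u v)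

    near-along : ∀ {S k u v} → Near k u → Walk G S u v → ∃[ k′ ] Near k′ v
    near-along near here           = _ , near
    near-along near (step a _ walk) = near-along (inj₂ (_ , near , a)) walk

    private
      shortest : ∀ v → ∃[ k ] (Near k v × (∀ {j} → j < k → ¬ Near j v))
      shortest v = minimal (λ k → near? k v) (proj₂ (near-along {k = 0} refl (connected v)))

    depth : Fin n → ℕ
    depth v = proj₁ (shortest v)

    near-depth : ∀ v → Near (depth v) v
    near-depth v = proj₁ (proj₂ (shortest v))

    depth-minimal : ∀ v {j} → j < depth v → ¬ Near j v
    depth-minimal v = proj₂ (proj₂ (shortest v))

    depth-least : ∀ {k v} → Near k v → depth v ≤ k
    depth-least {k} {v} near = ≮⇒≥ (λ k<depth → depth-minimal v k<depth near)

    depth-root : depth r ≡ 0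
    depth-root = n≤0⇒n≡0 (depth-least refl)

    depth≡0⇒≡root : ∀ {v} → depth v ≡ 0 → v ≡ r
    depth≡0⇒≡root {v} d≡0 = subst (λ k → Near k v) d≡0 (near-depth v)

    depth-adj : ∀ {u v} → Adj G u v → depth v ≤ suc (depth u)
    depth-adj {u} a = depth-least (inj₂ (u , near-depth u , a))

    earlier? : ∀ v u → Dec (Near (pred (depth v)) u × Adj G u v)
    earlier? v u = near? (pred (depth v)) u ×-dec adj? G u v

    earlier-neighbour : ∀ {v} → v ≢ r → ∃[ u ] (Near (pred (depth v)) u × Adj G u v)
    earlier-neighbour {v} v≢r with depth v | near-depth v | depth-minimal v
    ... | zero  | v≡r       | _     = contradiction v≡r v≢r
    ... | suc d | inj₁ near | below = contradiction near (below (n<1+n d))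
    ... | suc d | inj₂ e    | _     = e

    parent : Fin n → Fin n
    parent v with any? (earlier? v)
    ... | yes (u , _) = u
    ... | no _        = r  -- only at the root, which has no parent

    parent-earlier : ∀ {v} → v ≢ r → Near (pred (depth v)) (parent v) × Adj G (parent v) v
    parent-earlier {v} v≢r with any? (earlier? v)
    ... | yes (_ , earlier) = earlier
    ... | no none           = contradiction (earlier-neighbour v≢r) none

    parent-adj : ∀ {v} → v ≢ r → Adj G (parent v) v
    parent-adj v≢r = proj₂ (parent-earlier v≢r)

    depth-parent : ∀ {v} → v ≢ r → depth v ≡ suc (depth (parent v))
    depth-parent {v} v≢r = ≤-antisym (depth-adj (parent-adj v≢r)) (begin
      suc (depth (parent v)) ≤⟨ s≤s (depth-least (proj₁ (parent-earlier v≢r))) ⟩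
      suc (pred (depth v))   ≡⟨ suc-pred (depth v) ⟩
      depth v                ∎)
      where
      open ≤-Reasoning
      instance
        depth-nonZero : NonZero (depth v)
        depth-nonZero = ≢-nonZero (v≢r ∘ depth≡0⇒≡root)

  module RootedTree (T : Graph n) (r : Fin n) (connected : ∀ v → Walk T ⊤ r v)
                    (acyclic : ¬ HasCycleIn T ⊤) where

    open BreadthFirst T r connected public

    Child : Fin n → Fin n → Set
    Child x y = x ≢ r × parent x ≡ y

    ancestor : ℕ → Fin n → Fin n
    ancestor zero    v = v
    ancestor (suc i) v = parent (ancestor i v)

    private
      below-root-level : ∀ {x i v} → depth x + i ≡ depth v → i < depth v → x ≢ r
      below-root-level {i = i} level i<d refl =
        <-irrefl (trans (sym (cong (_+ i) depth-root)) level) i<d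

    depth-ancestor : ∀ {i v} → i ≤ depth v → depth (ancestor i v) + i ≡ depth v
    depth-ancestor {zero}  _     = +-identityʳ _
    depth-ancestor {suc i} {v} si≤d = begin
      depth (parent (ancestor i v)) + suc i    ≡⟨ +-suc _ i ⟩
      suc (depth (parent (ancestor i v))) + i  ≡⟨ cong (_+ i) (sym (depth-parent ancestor≢r)) ⟩
      depth (ancestor i v) + i                 ≡⟨ level ⟩
      depth v                                  ∎
      where
      open ≡-Reasoning
      level : depth (ancestor i v) + i ≡ depth v
      level = depth-ancestor (<⇒≤ si≤d)
      ancestor≢r : ancestor i v ≢ r
      ancestor≢r = below-root-level level si≤d

    ancestor-adj : ∀ {i v} → i < depth v → Adj T (ancestor (suc i) v) (ancestor i v)
    ancestor-adj i<d = parent-adj (below-root-level (depth-ancestor (<⇒≤ i<d)) i<d)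

    ancestor-depth : ∀ v → ancestor (depth v) v ≡ r
    ancestor-depth v = depth≡0⇒≡root (+-cancelʳ-≡ (depth v) _ 0 (depth-ancestor {depth v} ≤-refl))

    depth-ancestor-≤ : ∀ {i v} → i ≤ depth v → depth (ancestor i v) ≤ depth v
    depth-ancestor-≤ i≤d = m+n≤o⇒m≤o _ (≤-reflexive (depth-ancestor i≤d))

    ancestor-level : ∀ {i j u v} → i ≤ depth u → j ≤ depth v → depth u ≡ depth v →
                     ancestor i u ≡ ancestor j v → i ≡ j
    ancestor-level {i} {j} {u} {v} i≤ j≤ same meet = +-cancelˡ-≡ (depth (ancestor i u)) i j (begin
      depth (ancestor i u) + i  ≡⟨ trans (depth-ancestor i≤) same ⟩
      depth v                   ≡⟨ sym (depth-ancestor j≤) ⟩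
      depth (ancestor j v) + j  ≡⟨ cong (λ x → depth x + j) (sym meet) ⟩
      depth (ancestor i u) + j  ∎)
      where open ≡-Reasoning

    upward : ℕ → Fin n → List (Fin n)
    upward m v = applyUpTo (λ i → ancestor i v) (suc m)

    downward : ℕ → Fin n → List (Fin n)
    downward m v = applyDownFrom (λ i → ancestor i v) (suc m)

    upward-linked : ∀ {m v} → m ≤ depth v → Linked (Adj T) (upward m v)
    upward-linked m≤d = Linked.applyUpTo⁺₁ _ _ λ si<sm →
      Adj-sym T (ancestor-adj (<-≤-trans (s<s⁻¹ si<sm) m≤d))

    downward-linked : ∀ {m v} → m ≤ depth v → Linked (Adj T) (downward m v)
    downward-linked m≤d = Linked.applyDownFrom⁺₁ _ _ λ si<sm →
      ancestor-adj (<-≤-trans (s<s⁻¹ si<sm) m≤d)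

    upward-unique : ∀ {m v} → m ≤ depth v → Unique (upward m v)
    upward-unique {m} m≤d = Unique.applyUpTo⁺₁ _ (suc m) λ i<j j<sm →
      let j≤d = ≤-trans (s≤s⁻¹ j<sm) m≤d in
      <⇒≢ i<j ∘ ancestor-level (≤-trans (<⇒≤ i<j) j≤d) j≤d refl

    downward-unique : ∀ {m v} → m ≤ depth v → Unique (downward m v)
    downward-unique {m} m≤d = Unique.applyDownFrom⁺₁ _ (suc m) λ j<i i<sm →
      let i≤d = ≤-trans (s≤s⁻¹ i<sm) m≤d in
      <⇒≢ j<i ∘ sym ∘ ancestor-level i≤d (≤-trans (<⇒≤ j<i) i≤d) refl

    ∈-upward⁻ : ∀ {m v w} → w ∈ₗ upward m v → ∃[ i ] (i ≤ m × w ≡ ancestor i v)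
    ∈-upward⁻ w∈ with i , i<sm , w≡ ← ∈-applyUpTo⁻ _ w∈ = i , s≤s⁻¹ i<sm , w≡

    ∈-downward⁻ : ∀ {m v w} → w ∈ₗ downward m v → ∃[ i ] (i ≤ m × w ≡ ancestor i v)
    ∈-downward⁻ w∈ with i , i<sm , w≡ ← ∈-applyDownFrom⁻ _ w∈ = i , s≤s⁻¹ i<sm , w≡

    common-ancestor-at-root : ∀ {a b} → depth a ≡ depth b → ancestor (depth a) a ≡ ancestor (depth a) b
    common-ancestor-at-root {a} {b} same =
      trans (ancestor-depth a) (sym (subst (λ k → ancestor k b ≡ r) (sym same) (ancestor-depth b)))

    record Bridge (a b : Fin n) : Set where
      field
        inner   : List (Fin n)
        linked  : Linked (Adj T) (a ∷ inner)
        unique  : Unique (a ∷ inner)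
        ends    : last (a ∷ inner) ≡ just b
        long    : 2 ≤ length inner
        shallow : ∀ {w} → w ∈ₗ a ∷ inner → depth w ≤ depth a

    bridge : ∀ {a b} → a ≢ b → depth a ≡ depth b → Bridge a b
    bridge {a} {b} a≢b same
      with minimal (λ k → ancestor k a ≟ ancestor k b) {depth a} (common-ancestor-at-root same)
    ... | zero  , a≡b  , _     = contradiction a≡b a≢b
    ... | suc j , meet , below = record
      { inner   = applyUpTo (λ i → ancestor (suc i) a) (suc j) ++ downward j b
      ; linked  = Linked.++⁺ (upward-linked sj≤da) joint (downward-linked j≤db)
      ; unique  = Unique.++⁺ (upward-unique sj≤da) (downward-unique j≤db) disjoint
      ; ends    = trans (last-++ (upward (suc j) a) _ _) (last-applyDownFrom _ j)
      ; long    = subst (2 ≤_) (sym (cong suc (length-++-sucʳ (applyUpTo (λ i → ancestor (2 + i) a) j) _ _)))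
                        (s≤s (s≤s z≤n))
      ; shallow = shallow
      }
      where
      sj≤da : suc j ≤ depth a
      sj≤da = ≮⇒≥ λ da<sj → below da<sj (common-ancestor-at-root same)
      sj≤db : suc j ≤ depth b
      sj≤db = subst (suc j ≤_) same sj≤da
      j≤db : j ≤ depth b
      j≤db = <⇒≤ sj≤db
      joint : Connected (Adj T) (last (upward (suc j) a)) (just (ancestor j b))
      joint = subst (λ l → Connected (Adj T) l _) (sym (last-applyUpTo (λ i → ancestor i a) (suc j)))
                    (just (subst (λ x → Adj T x (ancestor j b)) (sym meet) (ancestor-adj sj≤db)))
      disjoint : Disjoint (upward (suc j) a) (downward j b)
      disjoint (w∈up , w∈down) with ∈-upward⁻ w∈up | ∈-downward⁻ w∈down
      ... | i , i≤sj , refl | i′ , i′≤j , meet′ =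
        below (s≤s i′≤j) (subst (λ k → ancestor k a ≡ ancestor i′ b) level meet′)
        where
        level : i ≡ i′
        level = ancestor-level (≤-trans i≤sj sj≤da) (≤-trans i′≤j j≤db) same meet′
      shallow : ∀ {w} → w ∈ₗ upward (suc j) a ++ downward j b → depth w ≤ depth a
      shallow w∈ with ∈-++⁻ (upward (suc j) a) w∈
      ... | inj₁ w∈up   with i , i≤ , refl ← ∈-upward⁻ w∈up   = depth-ancestor-≤ (≤-trans i≤ sj≤da)
      ... | inj₂ w∈down with i , i≤ , refl ← ∈-downward⁻ w∈down =
        subst (depth (ancestor i b) ≤_) (sym same) (depth-ancestor-≤ (≤-trans i≤ j≤db))

    -- An edge that is not a parent edge would close a bridge into a cycle.
    private
      deeper⇒≢root : ∀ {u v} → depth u < depth v → v ≢ r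
      deeper⇒≢root {u} u<v refl = contradiction (subst (depth u <_) depth-root u<v) λ ()

      level-edge-free : ∀ {u v} → Adj T u v → depth u ≢ depth v
      level-edge-free a same = acyclic (closed-path⇒cycle T linked ends (Adj-sym T a) unique long)
        where open Bridge (bridge (Adj⇒≢ T a) same)

      downward-edge : ∀ {u v} → Adj T u v → depth u < depth v → Child v u
      downward-edge {u} {v} a u<v with parent v ≟ u
      ... | yes parent≡u = deeper⇒≢root u<v , parent≡u
      ... | no  parent≢u = contradiction cycle acyclic
        where
        v≢r : v ≢ r
        v≢r = deeper⇒≢root u<v
        deeper : depth v ≡ suc (depth u)
        deeper = ≤-antisym (depth-adj a) u<v
        open Bridge (bridge (parent≢u ∘ sym) (suc-injective (trans (sym deeper) (depth-parent v≢r))))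
        fresh : All (v ≢_) (u ∷ inner)
        fresh = All.tabulate λ {w} w∈ v≡w →
          <-irrefl deeper (s≤s (subst (λ x → depth x ≤ depth u) (sym v≡w) (shallow w∈)))
        cycle : HasCycleIn T ⊤
        cycle = closed-path⇒cycle T (Adj-sym T a ∷ linked) ends (parent-adj v≢r) (fresh ∷ unique)
                                  (m≤n⇒m≤1+n long)

    parent-edge : ∀ {u v} → Adj T u v → Child v u ⊎ Child u v
    parent-edge {u} {v} a with <-cmp (depth u) (depth v)
    ... | tri< u<v _ _    = inj₁ (downward-edge a u<v)
    ... | tri≈ _ same _   = contradiction same (level-edge-free a)
    ... | tri> _ _ v<u    = inj₂ (downward-edge (Adj-sym T a) v<u)

    parent-induction : ∀ {ℓ} (P : Fin n → Set ℓ) → P r → (∀ {v} → v ≢ r → P (parent v) → P v) → ∀ v → P v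
    parent-induction P base grow v = go (depth v) v refl
      where
      go : ∀ k v → depth v ≡ k → P v
      go k v d with v ≟ r
      ... | yes refl = base
      go zero    v d | no v≢r = contradiction (depth≡0⇒≡root d) v≢r
      go (suc k) v d | no v≢r = grow v≢r (go k (parent v) (suc-injective (trans (sym (depth-parent v≢r)) d)))

    infix 4 _≼_
    data _≼_ (x : Fin n) : Fin n → Set where
      ≼-refl : x ≼ x
      ≼-step : ∀ {v} → v ≢ r → x ≼ parent v → x ≼ v

    ≼-trans : ∀ {x y v} → x ≼ y → y ≼ v → x ≼ v
    ≼-trans x≼y ≼-refl           = x≼y
    ≼-trans x≼y (≼-step v≢r y≼p) = ≼-step v≢r (≼-trans x≼y y≼p)

    child⇒≼ : ∀ {x y} → Child x y → y ≼ x
    child⇒≼ (x≢r , refl) = ≼-step x≢r ≼-refl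

    root≼ : ∀ v → r ≼ v
    root≼ = parent-induction (r ≼_) ≼-refl ≼-step

    ≼-root : ∀ {x} → x ≼ r → x ≡ r
    ≼-root ≼-refl           = refl
    ≼-root (≼-step r≢r _)  = contradiction refl r≢r

    ≼-parent : ∀ {x v} → x ≼ v → x ≢ v → x ≼ parent v
    ≼-parent ≼-refl         x≢x = contradiction refl x≢x
    ≼-parent (≼-step _ x≼p) _   = x≼p

    depth-parent-< : ∀ {v} → v ≢ r → depth (parent v) < depth v
    depth-parent-< v≢r = ≤-reflexive (sym (depth-parent v≢r))

    ≼-depth : ∀ {x v} → x ≼ v → depth x ≤ depth v
    ≼-depth ≼-refl             = ≤-refl
    ≼-depth (≼-step v≢r x≼p)   = ≤-trans (≼-depth x≼p) (<⇒≤ (depth-parent-< v≢r))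

    ≼-depth-≡ : ∀ {x v} → x ≼ v → depth v ≤ depth x → x ≡ v
    ≼-depth-≡ ≼-refl           _     = refl
    ≼-depth-≡ (≼-step v≢r x≼p) dv≤dx =
      contradiction (≤-trans dv≤dx (≼-depth x≼p)) (<⇒≱ (depth-parent-< v≢r))

    ≼-linear : ∀ {a b v} → a ≼ v → b ≼ v → depth a ≤ depth b → a ≼ b
    ≼-linear a≼v ≼-refl _ = a≼v
    ≼-linear {a} a≼v (≼-step {v} v≢r b≼p) da≤db with a ≟ v
    ... | yes refl = contradiction (≤-trans da≤db (≼-depth b≼p)) (<⇒≱ (depth-parent-< v≢r))
    ... | no  a≢v  = ≼-linear (≼-parent a≼v a≢v) b≼p da≤db

    ≼-child : ∀ {x v} → x ≼ v → x ≢ v → ∃[ c ] (Child c x × c ≼ v)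
    ≼-child ≼-refl x≢x = contradiction refl x≢x
    ≼-child {x} (≼-step {v} v≢r x≼p) _ with parent v ≟ x
    ... | yes p≡x = v , (v≢r , p≡x) , ≼-refl
    ... | no  p≢x with c , c-child , c≼p ← ≼-child x≼p (p≢x ∘ sym) = c , c-child , ≼-step v≢r c≼p

    _≼?_ : ∀ x v → Dec (x ≼ v)
    x ≼? v = parent-induction (λ v → Dec (x ≼ v)) (map′ (λ { refl → ≼-refl }) ≼-root (x ≟ r)) grow v
      where
      grow : ∀ {v} → v ≢ r → Dec (x ≼ parent v) → Dec (x ≼ v)
      grow {v} v≢r x≼?p with x ≟ v
      ... | yes refl = yes ≼-refl
      ... | no  x≢v  = map′ (≼-step v≢r) (λ x≼v → ≼-parent x≼v x≢v) x≼?p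

    child? : ∀ x y → Dec (Child x y)
    child? x y = ¬? (x ≟ r) ×-dec parent x ≟ y

    subtree : Fin n → Subset n
    subtree x = subset (x ≼?_)

    size : Fin n → ℕ
    size x = ∣ subtree x ∣

    size-child : ∀ {x y} → Child x y → size x < size y
    size-child {x} {y} x-child = p⊂q⇒∣p∣<∣q∣ (below , y , ∈-subset⁺ (y ≼?_) ≼-refl , y∉)
      where
      below : subtree x ⊆ subtree y
      below v∈ = ∈-subset⁺ (y ≼?_) (≼-trans (child⇒≼ x-child) (∈-subset⁻ (x ≼?_) v∈))
      y∉ : y ∉ subtree x
      y∉ y∈ = <⇒≱ (subst (λ p → depth p < depth x) (proj₂ x-child) (depth-parent-< (proj₁ x-child)))
                  (≼-depth (∈-subset⁻ (x ≼?_) y∈))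

    descend : ∀ {ℓ} {Q : Pred (Fin n) ℓ} → Decidable Q → ∀ {v} → Q v →
              ∃[ y ] (v ≼ y × Q y × (∀ {x} → Child x y → ¬ Q x))
    descend {Q = Q} Q? {v} qv = go v (<-wellFounded (size v)) qv
      where
      go : ∀ v → Acc _<_ (size v) → Q v → ∃[ y ] (v ≼ y × Q y × (∀ {x} → Child x y → ¬ Q x))
      go v (acc smaller) qv with any? (λ x → child? x v ×-dec Q? x)
      ... | no none = v , ≼-refl , qv , λ x-child qx → none (_ , x-child , qx)
      ... | yes (x , x-child , qx) with y , x≼y , qy , top ← go x (smaller (size-child x-child)) qx =
        y , ≼-trans (child⇒≼ x-child) x≼y , qy , top

    siblings-meet⇒≡ : ∀ {c w w′ v} → Child w c → Child w′ c → w ≼ v → w′ ≼ v → w ≡ w′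
    siblings-meet⇒≡ {w = w} {w′} (w≢r , refl) (w′≢r , p≡p) w≼v w′≼v =
      ≼-depth-≡ (≼-linear w≼v w′≼v (≤-reflexive same)) (≤-reflexive (sym same))
      where
      same : depth w ≡ depth w′
      same = trans (depth-parent w≢r) (trans (cong (suc ∘ depth) (sym p≡p)) (sym (depth-parent w′≢r)))

  crossing-step : 5 * n < 8 * a → a ≤ b + s → 4 * s ≤ n → 3 * n ≤ 8 * b
  crossing-step {n} {a} {b} {s} 5n<8a a≤b+s 4s≤n =
    <⇒≤ (+-cancelʳ-< (2 * n) (3 * n) (8 * b) (begin-strict
      3 * n + 2 * n        ≡⟨ sym (*-distribʳ-+ n 3 2) ⟩
      5 * n                <⟨ 5n<8a ⟩
      8 * a                ≤⟨ *-monoʳ-≤ 8 a≤b+s ⟩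
      8 * (b + s)          ≡⟨ *-distribˡ-+ 8 b s ⟩
      8 * b + 8 * s        ≡⟨ cong (8 * b +_) (*-assoc 2 4 s) ⟩
      8 * b + 2 * (4 * s)  ≤⟨ +-monoʳ-≤ (8 * b) (*-monoʳ-≤ 2 4s≤n) ⟩
      8 * b + 2 * n        ∎))
    where open ≤-Reasoning

  complement-≤ : a + b ≡ n → 3 * n ≤ 8 * a → 8 * b ≤ 5 * n
  complement-≤ {a} {b} {n} a+b≡n 3n≤8a = +-cancelʳ-≤ (3 * n) (8 * b) (5 * n) (begin
    8 * b + 3 * n  ≤⟨ +-monoʳ-≤ (8 * b) 3n≤8a ⟩
    8 * b + 8 * a  ≡⟨ sym (*-distribˡ-+ 8 b a) ⟩
    8 * (b + a)    ≡⟨ cong (8 *_) (trans (+-comm b a) a+b≡n) ⟩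
    8 * n          ≡⟨ *-distribʳ-+ n 5 3 ⟩
    5 * n + 3 * n  ∎)
    where open ≤-Reasoning

  complement-≥ : a + b ≡ n → 8 * a ≤ 5 * n → 3 * n ≤ 8 * b
  complement-≥ {a} {b} {n} a+b≡n 8a≤5n = +-cancelʳ-≤ (5 * n) (3 * n) (8 * b) (begin
    3 * n + 5 * n  ≡⟨ sym (*-distribʳ-+ n 3 5) ⟩
    8 * n          ≡⟨ cong (8 *_) (sym a+b≡n) ⟩
    8 * (a + b)    ≡⟨ *-distribˡ-+ 8 a b ⟩
    8 * a + 8 * b  ≤⟨ +-monoˡ-≤ (8 * b) 8a≤5n ⟩
    5 * n + 8 * b  ≡⟨ +-comm (5 * n) (8 * b) ⟩
    8 * b + 5 * n  ∎)
    where open ≤-Reasoning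

  heavy-remainder : n ≤ a + s → 8 * s < 3 * n → 5 * n < 8 * a
  heavy-remainder {n} {a} {s} n≤a+s 8s<3n = +-cancelʳ-< (3 * n) (5 * n) (8 * a) (begin-strict
    5 * n + 3 * n  ≡⟨ sym (*-distribʳ-+ n 5 3) ⟩
    8 * n          ≤⟨ *-monoʳ-≤ 8 n≤a+s ⟩
    8 * (a + s)    ≡⟨ *-distribˡ-+ 8 a s ⟩
    8 * a + 8 * s  <⟨ +-monoʳ-< (8 * a) 8s<3n ⟩
    8 * a + 3 * n  ∎)
    where open ≤-Reasoning

  one-boundary-remainder : a + s ≤ n + 1 → 5 * n < 8 * s → 4 ≤ n → 8 * a ≤ 5 * n
  one-boundary-remainder {a} {s} {n} a+s≤n+1 5n<8s 4≤n =
    <⇒≤ (+-cancelʳ-< (5 * n) (8 * a) (5 * n) (begin-strict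
      8 * a + 5 * n  <⟨ +-monoʳ-< (8 * a) 5n<8s ⟩
      8 * a + 8 * s  ≡⟨ sym (*-distribˡ-+ 8 a s) ⟩
      8 * (a + s)    ≤⟨ *-monoʳ-≤ 8 a+s≤n+1 ⟩
      8 * (n + 1)    ≡⟨ *-distribˡ-+ 8 n 1 ⟩
      8 * n + 8      ≤⟨ +-monoʳ-≤ (8 * n) (*-monoʳ-≤ 2 4≤n) ⟩
      8 * n + 2 * n  ≡⟨ rearrange ⟩
      5 * n + 5 * n  ∎))
    where
    open ≤-Reasoning
    rearrange : 8 * n + 2 * n ≡ 5 * n + 5 * n
    rearrange = solve 1 (λ n → con 8 :* n :+ con 2 :* n := con 5 :* n :+ con 5 :* n) refl n

  two-boundary-remainder : a + (s + t) ≤ n + 2 → n < 4 * s → n < 4 * t → 12 ≤ n → 8 * a ≤ 5 * n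
  two-boundary-remainder {a} {s} {t} {n} a+s+t≤n+2 n<4s n<4t 12≤n =
    +-cancelʳ-≤ (4 * suc n) (8 * a) (5 * n) (begin
      8 * a + 4 * suc n                    ≡⟨ cong (8 * a +_) (*-distribʳ-+ (suc n) 2 2) ⟩
      8 * a + (2 * suc n + 2 * suc n)      ≤⟨ +-monoʳ-≤ (8 * a) (+-mono-≤ (*-monoʳ-≤ 2 n<4s)
                                                                           (*-monoʳ-≤ 2 n<4t)) ⟩
      8 * a + (2 * (4 * s) + 2 * (4 * t))  ≡⟨ regroup ⟩
      8 * (a + (s + t))                    ≤⟨ *-monoʳ-≤ 8 a+s+t≤n+2 ⟩
      8 * (n + 2)                          ≡⟨ *-distribˡ-+ 8 n 2 ⟩
      8 * n + (4 + 12)                     ≤⟨ +-monoʳ-≤ (8 * n) (+-monoʳ-≤ 4 12≤n) ⟩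
      8 * n + (4 + n)                      ≡⟨ rearrange ⟩
      5 * n + 4 * suc n                    ∎)
    where
    open ≤-Reasoning
    regroup : 8 * a + (2 * (4 * s) + 2 * (4 * t)) ≡ 8 * (a + (s + t))
    regroup = solve 3 (λ a s t → con 8 :* a :+ (con 2 :* (con 4 :* s) :+ con 2 :* (con 4 :* t))
                                 := con 8 :* (a :+ (s :+ t))) refl a s t
    rearrange : 8 * n + (4 + n) ≡ 5 * n + 4 * suc n
    rearrange = solve 1 (λ n → con 8 :* n :+ (con 4 :+ n) := con 5 :* n :+ con 4 :* (con 1 :+ n)) refl n

  5n<8n : 1 ≤ n → 5 * n < 8 * n
  5n<8n {n} 1≤n = *-monoˡ-< n {{>-nonZero 1≤n}} {5} {8} (m<m+n 5 z<s)

  ThinBoundary : Graph n → Subset n → Set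
  ThinBoundary G A =
    ∃[ X ] ((∀ v → v ∈ X ⇔ (v ∈ A × ∃[ w ] (w ∈ ∁ A × Adj G v w))) × Independent G X × ∣ X ∣ ≤ 2)

  module Splitting (T : Graph n) (r : Fin n) (connected : ∀ v → Walk T ⊤ r v)
                   (acyclic : ¬ HasCycleIn T ⊤) (12≤n : 12 ≤ n) where

    open RootedTree T r connected acyclic

    private
      1≤n : 1 ≤ n
      1≤n = ≤-trans (s≤s z≤n) 12≤n

      4≤n : 4 ≤ n
      4≤n = ≤-trans (m≤m+n 4 8) 12≤n

    record Cut (y z : Fin n) (S : Subset n) : Set where
      field
        root∈    : r ∈ S
        closed   : ∀ {x v} → x ≼ v → v ∈ S → x ∈ S
        boundary : ∀ {v w} → v ∈ S → w ∉ S → Adj T v w → v ≡ y ⊎ v ≡ z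

    ⊤-cut : ∀ {y z} → Cut y z ⊤
    ⊤-cut = record { root∈ = ∈⊤ ; closed = λ _ _ → ∈⊤ ; boundary = λ _ w∉⊤ _ → contradiction ∈⊤ w∉⊤ }

    cut-prune : ∀ {y z S x} → Cut y z S → Child x y ⊎ Child x z → Cut y z (S ─ subtree x)
    cut-prune {y} {z} {S} {x} cut x-child =
      record { root∈ = root∈′ ; closed = closed′ ; boundary = boundary′ }
      where
      open Cut cut
      keep : ∀ {v} → v ∈ S → ¬ x ≼ v → v ∈ S ─ subtree x
      keep v∈S x⋠v = x∈p∧x∉q⇒x∈p─q v∈S (x⋠v ∘ ∈-subset⁻ (x ≼?_))
      kept : ∀ {v} → v ∈ S ─ subtree x → v ∈ S × ¬ x ≼ v
      kept v∈ = p─q⊆p S (subtree x) v∈ , x∈p─q⇒x∉q v∈ ∘ ∈-subset⁺ (x ≼?_)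
      root∈′ : r ∈ S ─ subtree x
      root∈′ = keep root∈ ([ proj₁ , proj₁ ]′ x-child ∘ ≼-root)
      closed′ : ∀ {u v} → u ≼ v → v ∈ S ─ subtree x → u ∈ S ─ subtree x
      closed′ u≼v v∈ with v∈S , x⋠v ← kept v∈ = keep (closed u≼v v∈S) (x⋠v ∘ flip ≼-trans u≼v)
      boundary′ : ∀ {v w} → v ∈ S ─ subtree x → w ∉ S ─ subtree x → Adj T v w → v ≡ y ⊎ v ≡ z
      boundary′ {v} {w} v∈ w∉ a with kept v∈ | w ∈? S | x ≼? w
      ... | v∈S , _   | no w∉S  | _      = boundary v∈S w∉S a
      ... | _   , _   | yes w∈S | no x⋠w = contradiction (keep w∈S x⋠w) w∉
      ... | _   , x⋠v | yes _   | yes x≼w with parent-edge a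
      ...   | inj₂ v-child = contradiction (≼-trans x≼w (child⇒≼ v-child)) x⋠v
      ...   | inj₁ (_ , pw≡v) with x ≟ w
      ...     | yes refl = Sum.map (trans (sym pw≡v) ∘ proj₂) (trans (sym pw≡v) ∘ proj₂) x-child
      ...     | no  x≢w  = contradiction (subst (x ≼_) pw≡v (≼-parent x≼w x≢w)) x⋠v

    Balanced : ℕ → Set
    Balanced a = 3 * n ≤ 8 * a × 8 * a ≤ 5 * n

    balanced? : Decidable Balanced
    balanced? a = 3 * n ≤? 8 * a ×-dec 8 * a ≤? 5 * n

    BalancedCut : Fin n → Fin n → Set
    BalancedCut y z = ∃[ S ] (Cut y z S × Balanced ∣ S ∣)

    Heavy Big Small : Fin n → Set
    Heavy x = 5 * n < 8 * size x
    Big   x = n < 4 * size x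
    Small x = 4 * size x ≤ n

    heavy? : Decidable Heavy
    heavy? x = 5 * n <? 8 * size x

    big? : Decidable Big
    big? x = n <? 4 * size x

    Prunable : Fin n → Fin n → Fin n → Set
    Prunable y z x = (Child x y ⊎ Child x z) × Small x

    prunable? : ∀ y z → Decidable (Prunable y z)
    prunable? y z x = (child? x y ⊎-dec child? x z) ×-dec (4 * size x ≤? n)

    pruned : Fin n → Fin n → Subset n
    pruned y z = ⋃ (map subtree (filter (prunable? y z) (allFin n)))

    -- Discrete intermediate value theorem: steps of at most n/4 cannot jump over [3n/8, 5n/8].
    crossing : ∀ {y z S} xs → All (Prunable y z) xs → Cut y z S → 5 * n < 8 * ∣ S ∣ →
               8 * ∣ S ─ ⋃ (map subtree xs) ∣ ≤ 5 * n → BalancedCut y z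
    crossing {S = S} [] _ _ heavy light =
      contradiction (subst (λ p → 8 * ∣ p ∣ ≤ 5 * n) (p─⊥≡p S) light) (<⇒≱ heavy)
    crossing {S = S} (x ∷ xs) ((x-child , x-small) ∷ rest) cut heavy light
      with 8 * ∣ S ─ subtree x ∣ ≤? 5 * n
    ... | yes light′ = S ─ subtree x , cut-prune cut x-child ,
                       crossing-step {b = ∣ S ─ subtree x ∣} heavy (∣p∣≤∣p─q∣+∣q∣ S (subtree x)) x-small ,
                       light′
    ... | no  heavy′ = crossing xs rest (cut-prune cut x-child) (≰⇒> heavy′)
                         (subst (λ p → 8 * ∣ p ∣ ≤ 5 * n) (sym (p─q─r≡p─q∪r S (subtree x) _)) light)

    prune : ∀ {y z S} → Cut y z S → 5 * n < 8 * ∣ S ∣ → 8 * ∣ S ─ pruned y z ∣ ≤ 5 * n → BalancedCut y z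
    prune {y} {z} = crossing _ (all-filter (prunable? y z) (allFin n))

    pruned-below : ∀ {y z S u v} → Cut y z S → (∀ {x} → Child x u → Child x y ⊎ Child x z) →
                   (∀ {x} → Child x u → x ∈ S → Small x) → v ∈ S ─ pruned y z → u ≼ v → v ≡ u
    pruned-below {y} {z} {S} {u} {v} cut adopted small v∈ u≼v with v ≟ u
    ... | yes v≡u = v≡u
    ... | no  v≢u with x , x-child , x≼v ← ≼-child u≼v (v≢u ∘ sym) =
      contradiction (∈-⋃⁺ (∈-map⁺ subtree x-prunable) (∈-subset⁺ (x ≼?_) x≼v)) (x∈p─q⇒x∉q v∈)
      where
      x-prunable : x ∈ₗ filter (prunable? y z) (allFin n)
      x-prunable = ∈-filter⁺ (prunable? y z) (∈-allFin x)
                     (adopted x-child , small x-child (Cut.closed cut x≼v (p─q⊆p S _ v∈)))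

    one-boundary : ∀ {c S} → Cut c c S → Heavy c → (∀ {x} → Child x c → x ∈ S → Small x) →
                   8 * ∣ S ─ pruned c c ∣ ≤ 5 * n
    one-boundary {c} {S} cut c-heavy small =
      one-boundary-remainder {a = ∣ F ∣} remainder c-heavy 4≤n
      where
      F : Subset n
      F = S ─ pruned c c
      top : ∀ {v} → v ∈ F ∩ subtree c → v ∈ ⁅ c ⁆
      top v∈ with v∈F , v∈c ← x∈p∩q⁻ F _ v∈ =
        subst (_∈ ⁅ c ⁆) (sym (pruned-below cut inj₁ small v∈F (∈-subset⁻ (c ≼?_) v∈c))) (x∈⁅x⁆ c)
      common : ∣ F ∩ subtree c ∣ ≤ 1
      common = ≤-trans (p⊆q⇒∣p∣≤∣q∣ top) (≤-reflexive (∣⁅x⁆∣≡1 c))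
      remainder : ∣ F ∣ + size c ≤ n + 1
      remainder = ≤-trans (∣p∣+∣q∣≤n+∣p∩q∣ F (subtree c)) (+-monoʳ-≤ n common)

    two-boundary : ∀ {y z S} → Cut y z S → Empty (subtree y ∩ subtree z) → Big y → Big z →
                   (∀ {x} → Child x y → Small x) → (∀ {x} → Child x z → Small x) →
                   8 * ∣ S ─ pruned y z ∣ ≤ 5 * n
    two-boundary {y} {z} {S} cut disjoint y-big z-big y-small z-small =
      two-boundary-remainder {a = ∣ F ∣} {s = size y} {t = size z} remainder y-big z-big 12≤n
      where
      F : Subset n
      F = S ─ pruned y z
      top : ∀ {v} → v ∈ F ∩ (subtree y ∪ subtree z) → v ≡ y ⊎ v ≡ z
      top v∈ with v∈F , v∈yz ← x∈p∩q⁻ F _ v∈ | x∈p∪q⁻ (subtree y) _ (proj₂ (x∈p∩q⁻ F _ v∈))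
      ... | inj₁ v∈y = inj₁ (pruned-below cut inj₁ (λ x-child _ → y-small x-child) v∈F
                                          (∈-subset⁻ (y ≼?_) v∈y))
      ... | inj₂ v∈z = inj₂ (pruned-below cut inj₂ (λ x-child _ → z-small x-child) v∈F
                                          (∈-subset⁻ (z ≼?_) v∈z))
      common : ∣ F ∩ (subtree y ∪ subtree z) ∣ ≤ 2
      common = ≤-trans (p⊆q⇒∣p∣≤∣q∣ (∈-⁅x⁆∪⁅y⁆⁺ ∘ top)) (∣⁅x⁆∪⁅y⁆∣≤2 y z)
      remainder : ∣ F ∣ + (size y + size z) ≤ n + 2
      remainder = subst (λ m → ∣ F ∣ + m ≤ n + 2) (Empty[p∩q]⇒∣p∪q∣≡∣p∣+∣q∣ _ _ disjoint)
                    (≤-trans (∣p∣+∣q∣≤n+∣p∩q∣ F (subtree y ∪ subtree z)) (+-monoʳ-≤ n common))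

    ∣⊤─subtree∣+size : ∀ x → ∣ ⊤ ─ subtree x ∣ + size x ≡ n
    ∣⊤─subtree∣+size x = ≤-antisym (∣p─q∣+∣q∣≤n ⊤ (subtree x))
      (subst (_≤ ∣ ⊤ ─ subtree x ∣ + size x) (∣⊤∣≡n n) (∣p∣≤∣p─q∣+∣q∣ ⊤ (subtree x)))

    ⊤-heavy : 5 * n < 8 * ∣ ⊤ {n} ∣
    ⊤-heavy = subst (λ m → 5 * n < 8 * m) (sym (∣⊤∣≡n n)) (5n<8n 1≤n)

    root-heavy : Heavy r
    root-heavy = <-≤-trans ⊤-heavy (*-monoʳ-≤ 8 (p⊆q⇒∣p∣≤∣q∣ {p = ⊤} λ _ → ∈-subset⁺ (r ≼?_) (root≼ _)))

    complement-cut : ∀ {x} → x ≢ r → Balanced (size x) → BalancedCut (parent x) (parent x)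
    complement-cut {x} x≢r (3n≤8x , 8x≤5n) =
      ⊤ ─ subtree x , cut-prune ⊤-cut (inj₁ (x≢r , refl)) ,
      complement-≥ {b = ∣ ⊤ ─ subtree x ∣} sum 8x≤5n , complement-≤ {b = ∣ ⊤ ─ subtree x ∣} sum 3n≤8x
      where
      sum : size x + ∣ ⊤ ─ subtree x ∣ ≡ n
      sum = trans (+-comm (size x) _) (∣⊤─subtree∣+size x)

    two-branches : ∀ {c w w′} → Child w c → Child w′ c → w ≢ w′ → Big w → Big w′ →
                   ∃[ y ] ∃[ z ] (¬ Adj T y z × BalancedCut y z)
    two-branches w-child w′-child w≢w′ w-big w′-big
      with y , w≼y  , y-big , y-top ← descend big? w-big
         | z , w′≼z , z-big , z-top ← descend big? w′-big =
      y , z , y≁z ,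
      prune ⊤-cut ⊤-heavy (two-boundary ⊤-cut disjoint y-big z-big (≮⇒≥ ∘ y-top) (≮⇒≥ ∘ z-top))
      where
      disjoint : Empty (subtree y ∩ subtree z)
      disjoint (v , v∈) with v∈y , v∈z ← x∈p∩q⁻ (subtree y) _ v∈ =
        w≢w′ (siblings-meet⇒≡ w-child w′-child (≼-trans w≼y (∈-subset⁻ (y ≼?_) v∈y))
                                                 (≼-trans w′≼z (∈-subset⁻ (z ≼?_) v∈z)))
      y≁z : ¬ Adj T y z
      y≁z a with parent-edge a
      ... | inj₁ z-child = disjoint (z , x∈p∩q⁺ (∈-subset⁺ (y ≼?_) (child⇒≼ z-child) ,
                                                 ∈-subset⁺ (z ≼?_) ≼-refl))
      ... | inj₂ y-child = disjoint (y , x∈p∩q⁺ (∈-subset⁺ (y ≼?_) ≼-refl ,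
                                                 ∈-subset⁺ (z ≼?_) (child⇒≼ y-child)))

    under-heavy : ∀ {c} → Heavy c → (∀ {x} → Child x c → 8 * size x < 3 * n) →
                  ∃[ y ] ∃[ z ] (¬ Adj T y z × BalancedCut y z)
    under-heavy {c} c-heavy thin with any? (λ w → child? w c ×-dec big? w)
    ... | no none = c , c , Adj-irrefl T , prune ⊤-cut ⊤-heavy (one-boundary ⊤-cut c-heavy small)
      where
      small : ∀ {x} → Child x c → x ∈ ⊤ → Small x
      small x-child _ = ≮⇒≥ λ x-big → none (_ , x-child , x-big)
    ... | yes (w , w-child , w-big) with any? (λ w′ → child? w′ c ×-dec big? w′ ×-dec ¬? (w′ ≟ w))
    ...   | yes (w′ , w′-child , w′-big , w′≢w) = two-branches w′-child w-child w′≢w w′-big w-big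
    ...   | no none = c , c , Adj-irrefl T , prune cut rest-heavy (one-boundary cut c-heavy small)
      where
      cut : Cut c c (⊤ ─ subtree w)
      cut = cut-prune ⊤-cut (inj₁ w-child)
      rest-heavy : 5 * n < 8 * ∣ ⊤ ─ subtree w ∣
      rest-heavy = heavy-remainder {s = size w} (≤-reflexive (sym (∣⊤─subtree∣+size w))) (thin w-child)
      small : ∀ {x} → Child x c → x ∈ ⊤ ─ subtree w → Small x
      small x-child x∈ = ≮⇒≥ λ x-big → none (_ , x-child , x-big , λ { refl →
        x∈p─q⇒x∉q x∈ (∈-subset⁺ (w ≼?_) ≼-refl) })

    balanced-cut : ∃[ y ] ∃[ z ] (¬ Adj T y z × BalancedCut y z)
    balanced-cut with c , _ , c-heavy , c-top ← descend heavy? root-heavy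
                 with any? (λ x → child? x c ×-dec balanced? (size x))
    ... | yes (x , (x≢r , _) , x-balanced) =
      parent x , parent x , Adj-irrefl T , complement-cut x≢r x-balanced
    ... | no  unbalanced = under-heavy c-heavy thin
      where
      thin : ∀ {x} → Child x c → 8 * size x < 3 * n
      thin x-child = ≰⇒> λ 3n≤8x → unbalanced (_ , x-child , 3n≤8x , ≮⇒≥ (c-top x-child))

    cut-tree : ∀ {y z S} → Cut y z S → IsTreeOn T S
    cut-tree {S = S} cut = (r , root∈) , (λ u v u∈ v∈ → to-root u u∈ ◅◅ from-root v v∈) ,
      λ (x , xs , long , unique , _ , chain) →
        acyclic (x , xs , long , unique , All.universal (λ _ → ∈⊤) _ , chain)
      where
      open Cut cut
      parent∈ : ∀ {v} → v ≢ r → v ∈ S → parent v ∈ S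
      parent∈ v≢r = closed (child⇒≼ (v≢r , refl))
      to-root : ∀ v → v ∈ S → Walk T S v r
      to-root = parent-induction (λ v → v ∈ S → Walk T S v r) (λ _ → here)
        λ v≢r walk v∈ → step (Adj-sym T (parent-adj v≢r)) (parent∈ v≢r v∈) (walk (parent∈ v≢r v∈))
      from-root : ∀ v → v ∈ S → Walk T S r v
      from-root = parent-induction (λ v → v ∈ S → Walk T S r v) (λ _ → here)
        λ v≢r walk v∈ → walk (parent∈ v≢r v∈) ◅◅ step (parent-adj v≢r) v∈ here

    cut-boundary : ∀ {y z S} → Cut y z S → ¬ Adj T y z → ThinBoundary T S
    cut-boundary {y} {z} {S} cut y≁z =
      X , (λ v → mk⇔ (∈-subset⁻ attached?) (∈-subset⁺ attached?)) , independent ,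
      ≤-trans (p⊆q⇒∣p∣≤∣q∣ (∈-⁅x⁆∪⁅y⁆⁺ ∘ y-or-z)) (∣⁅x⁆∪⁅y⁆∣≤2 y z)
      where
      attached? : ∀ v → Dec (v ∈ S × ∃[ w ] (w ∈ ∁ S × Adj T v w))
      attached? v = v ∈? S ×-dec any? (λ w → w ∈? ∁ S ×-dec adj? T v w)
      X : Subset n
      X = subset attached?
      y-or-z : ∀ {v} → v ∈ X → v ≡ y ⊎ v ≡ z
      y-or-z v∈ with v∈S , _ , w∈∁S , a ← ∈-subset⁻ attached? v∈ = Cut.boundary cut v∈S (x∈∁p⇒x∉p w∈∁S) a
      independent : Independent T X
      independent u v u∈ v∈ a with y-or-z u∈ | y-or-z v∈
      ... | inj₁ refl | inj₁ refl = Adj-irrefl T a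
      ... | inj₁ refl | inj₂ refl = y≁z a
      ... | inj₂ refl | inj₁ refl = y≁z (Adj-sym T a)
      ... | inj₂ refl | inj₂ refl = Adj-irrefl T a

    balanced-split : ∃[ A ] (8 * ∣ A ∣ ≤ 5 * n × 8 * ∣ ∁ A ∣ ≤ 5 * n × IsTreeOn T A × ThinBoundary T A)
    balanced-split with y , z , y≁z , S , cut , (3n≤8S , 8S≤5n) ← balanced-cut =
      S , 8S≤5n , complement-≤ {b = ∣ ∁ S ∣} (∣p∣+∣∁p∣≡n S) 3n≤8S , cut-tree cut , cut-boundary cut y≁z

  tree-split : ∀ {T : Graph n} → IsTree T → 12 ≤ n →
               ∃[ A ] (8 * ∣ A ∣ ≤ 5 * n × 8 * ∣ ∁ A ∣ ≤ 5 * n × IsTreeOn T A × ThinBoundary T A)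
  tree-split {T = T} ((r , _) , walks , acyclic) =
    Splitting.balanced-split T r (λ v → walks r v ∈⊤ ∈⊤) acyclic

open import Defs
open import Data.Nat using (ℕ)
open import Data.Fin.Subset using (Subset; _∈_; _∉_; ∣_∣; ∁)
open import Data.Product using (_×_; ∃-syntax; _,_)
open import Data.Integer using (+_)
open import Data.Rational using (ℚ; 0ℚ; _/_; _-_; _*_; _<_; _≤_; toℚᵘ; *<*; nonNegative)
open import Function.Bundles using (_⇔_)

import Data.Integer as ℤ
import Data.Integer.Properties as ℤ
import Data.Nat as ℕ
import Data.Nat.Properties as ℕ
open import Data.Rational.Properties
  using (toℚᵘ-fromℚᵘ; toℚᵘ-cancel-≤; toℚᵘ-homo-*; ≤-trans; *-monoʳ-≤-nonNeg; +-monoʳ-≤; neg-antimono-≤)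
open import Data.Rational.Unnormalised using (mkℚᵘ; *≤*) renaming (_≃_ to _≃ᵘ_; _≤_ to _≤ᵘ_; _*_ to _*ᵘ_)
open import Data.Rational.Unnormalised.Properties using (≃-sym; ≃-trans; ≤-respˡ-≃; ≤-respʳ-≃; *-congˡ)
import Relation.Binary.PropositionalEquality as ≡
open TreeSplitting using (tree-split)

-- ℕtoℚ a = + a / 1 does not normalise for a variable a, so we compare unnormalised rationals.
private
  toℚᵘ-ℕtoℚ : ∀ a → toℚᵘ (ℕtoℚ a) ≃ᵘ mkℚᵘ (+ a) 0
  toℚᵘ-ℕtoℚ a = toℚᵘ-fromℚᵘ (mkℚᵘ (+ a) 0)

ℕtoℚ-nonNeg : ∀ a → 0ℚ ≤ ℕtoℚ a
ℕtoℚ-nonNeg a = toℚᵘ-cancel-≤ (≤-respʳ-≃ (≃-sym (toℚᵘ-ℕtoℚ a))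
  (*≤* (≡.subst (+ 0 ℤ.≤_) (≡.sym (ℤ.*-identityʳ (+ a))) (ℤ.+≤+ ℕ.z≤n))))

ℕtoℚ-eighths : ∀ a n → 8 ℕ.* a ℕ.≤ 5 ℕ.* n → ℕtoℚ a ≤ + 5 / 8 * ℕtoℚ n
ℕtoℚ-eighths a n 8a≤5n =
  toℚᵘ-cancel-≤ (≤-respˡ-≃ (≃-sym (toℚᵘ-ℕtoℚ a)) (≤-respʳ-≃ (≃-sym rhs) scaled))
  where
  rhs : toℚᵘ (+ 5 / 8 * ℕtoℚ n) ≃ᵘ mkℚᵘ (+ 5) 7 *ᵘ mkℚᵘ (+ n) 0
  rhs = ≃-trans (toℚᵘ-homo-* (+ 5 / 8) (ℕtoℚ n)) (*-congˡ {toℚᵘ (+ 5 / 8)} (toℚᵘ-ℕtoℚ n))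
  scaled : mkℚᵘ (+ a) 0 ≤ᵘ mkℚᵘ (+ 5) 7 *ᵘ mkℚᵘ (+ n) 0
  scaled = *≤* (≡.subst₂ ℤ._≤_ (ℤ.pos-* a 8) (≡.trans (ℤ.pos-* 5 n) (≡.sym (ℤ.*-identityʳ _)))
                 (ℤ.+≤+ (≡.subst (ℕ._≤ 5 ℕ.* n) (ℕ.*-comm 8 a) 8a≤5n)))

-- 2/3 − 1/24 reduces to 5/8, so monotonicity of subtraction gives 5/8 ≤ 2/3 − ε.
eighths⇒two-thirds-minus : ∀ {ε} a n → ε ≤ + 1 / 24 → 8 ℕ.* a ℕ.≤ 5 ℕ.* n →
                           ℕtoℚ a ≤ (+ 2 / 3 - ε) * ℕtoℚ n
eighths⇒two-thirds-minus a n ε≤ 8a≤5n = ≤-trans (ℕtoℚ-eighths a n 8a≤5n)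
  (*-monoʳ-≤-nonNeg (ℕtoℚ n) {{nonNegative (ℕtoℚ-nonNeg n)}} (+-monoʳ-≤ (+ 2 / 3) (neg-antimono-≤ ε≤)))

proposition7p2 :
  ∃[ ε₀ ] (0ℚ < ε₀ × (∀ (ε : ℚ) → 0ℚ < ε → ε ≤ ε₀ →
    ∃[ n₀ ] (∀ (n : ℕ) → n₀ Data.Nat.≤ n → (T : Graph n) → IsTree T →
      ∃[ A ] (
        ℕtoℚ ∣ A ∣ ≤ ((+ 2 / 3) - ε) * ℕtoℚ n ×
        ℕtoℚ ∣ ∁ A ∣ ≤ ((+ 2 / 3) - ε) * ℕtoℚ n ×
        IsTreeOn T A ×
        ∃[ X ] (
          (∀ v → v ∈ X ⇔ (v ∈ A × ∃[ w ] (w ∈ ∁ A × Adj T v w))) ×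
          Independent T X ×
          ∣ X ∣ Data.Nat.≤ 2)))))
proposition7p2 = + 1 / 24 , *<* (ℤ.+<+ (ℕ.s≤s ℕ.z≤n)) , λ ε _ ε≤1/24 → 12 , λ n 12≤n T tree →
  let A , 8A≤5n , 8∁A≤5n , A-tree , thin = tree-split tree 12≤n
  in A , eighths⇒two-thirds-minus (∣ A ∣) n ε≤1/24 8A≤5n ,
     eighths⇒two-thirds-minus (∣ ∁ A ∣) n ε≤1/24 8∁A≤5n , A-tree , thin
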